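{- Let $p,q\ge 2$ be integers. Then there exist $n\ge \max(p,q)$ and two stable matching instances $A$ and $B$ on the same $n$ workers and $n$ firms that are $(p,q)$ such that $\mathcal{M}_A\cap\mathcal{M}_B$ is not a sublattice of $\mathcal{L}_A$.
   Context: A stable matching instance $I$ on workers $\mathcal{W}$ and firms $\mathcal{F}$ (with $|\mathcal{W}|=|\mathcal{F}|=n$) assigns to every agent a strict total order over the agents of the other side. For a perfect matching $M$, a pair $(w,f)\notin M$ is blocking under $I$ if $w$ prefers $f$ to $M(w)$ and $f$ prefers $w$ to $M(f)$; $M$ is stable under $I$ if it has no blocking pair. $\mathcal{M}_I$ is the set of stable matchings of $I$; $\mathcal{L}_I$ is the lattice on $\mathcal{M}_I$ with join $M\vee_I M'$ assigning each worker its less preferred (under $I$) partner among $M(w),M'(w)$ and meet $M\wedge_I M'$ assigning the more preferred one. A subset of $\mathcal{M}_I$ is a sublattice of $\mathcal{L}_I$ if closed under $\vee_I$ and $\wedge_I$. Two instances $A,B$ on the same agents are $(p,q)$ if there is a set of $p$ workers and a set of $q$ firms such that every agent outside these sets has the same preference list in $A$ and in $B$ (agents in these sets may change their lists, possibly not at all). -}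

module Defs where

open import Data.Nat using (ℕ; _≤_; _⊔_)
open import Data.Fin using (Fin; _<_)
open import Data.Fin.Subset using (Subset; _∈_; _∉_; ∣_∣)
open import Data.Product using (Σ; _×_; ∃-syntax)
open import Relation.Binary.PropositionalEquality using (_≡_)
open import Relation.Nullary using (¬_)
open import Function.Definitions using (Injective)
import Data.Fin
import Relation.Nullary

-- A strict total order over the n agents of the other side is encoded as an
-- injective (hence bijective) rank function: smaller rank = more preferred.
record Pref (n : ℕ) : Set where
  field
    rank   : Fin n → Fin n
    rank-inj : Injective _≡_ _≡_ rank
open Pref public

_prefers_over_ : ∀ {n} → Pref n → Fin n → Fin n → Set
P prefers x over y = rank P x < rank P y

record Instance (n : ℕ) : Set where
  field
    wpref : Fin n → Pref n
    fpref : Fin n → Pref n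
open Instance public

-- A perfect matching: an injective (hence bijective) map worker ↦ firm.
record Matching (n : ℕ) : Set where
  field
    mate     : Fin n → Fin n
    mate-inj : Injective _≡_ _≡_ mate
open Matching public

Blocking : ∀ {n} → Instance n → Matching n → Fin n → Fin n → Set
Blocking I M w f =
  ¬ (mate M w ≡ f) ×
  (wpref I w prefers f over mate M w) ×
  (∀ w' → mate M w' ≡ f → fpref I f prefers w over w')

Stable : ∀ {n} → Instance n → Matching n → Set
Stable I M = ∀ w f → ¬ Blocking I M w f

-- Join: each worker gets its less preferred partner (under I);
-- meet: each worker gets its more preferred partner.
joinMate : ∀ {n} → Instance n → Matching n → Matching n → Fin n → Fin n
joinMate I M M' w with Data.Fin._<?_ (rank (wpref I w) (mate M w)) (rank (wpref I w) (mate M' w))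
... | Relation.Nullary.yes _ = mate M' w
... | Relation.Nullary.no _  = mate M w

meetMate : ∀ {n} → Instance n → Matching n → Matching n → Fin n → Fin n
meetMate I M M' w with Data.Fin._<?_ (rank (wpref I w) (mate M w)) (rank (wpref I w) (mate M' w))
... | Relation.Nullary.yes _ = mate M w
... | Relation.Nullary.no _  = mate M' w

-- A set S of stable matchings of I (given as a predicate on matchings, assumed
-- contained in M_I) is a sublattice of L_I if closed under join and meet.
IsSublattice : ∀ {n} → Instance n → (Matching n → Set) → Set
IsSublattice I S =
  ∀ M M' → S M → S M' →
    Σ (Injective _≡_ _≡_ (joinMate I M M')) (λ ij → S record { mate = joinMate I M M' ; mate-inj = ij }) ×
    Σ (Injective _≡_ _≡_ (meetMate I M M')) (λ im → S record { mate = meetMate I M M' ; mate-inj = im })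

CommonStable : ∀ {n} → Instance n → Instance n → Matching n → Set
CommonStable A B M = Stable A M × Stable B M

SamePref : ∀ {n} → Pref n → Pref n → Set
SamePref P Q = ∀ x → rank P x ≡ rank Q x

IsPQ : ∀ {n} → ℕ → ℕ → Instance n → Instance n → Set
IsPQ {n} p q A B =
  Σ (Subset n) λ W → Σ (Subset n) λ F →
    ∣ W ∣ ≡ p × ∣ F ∣ ≡ q ×
    (∀ w → w ∉ W → SamePref (wpref A w) (wpref B w)) ×
    (∀ f → f ∉ F → SamePref (fpref A f) (fpref B f))

-- Four workers and four firms suffice: there are instances A₄ and B₄ that
-- differ only in the lists of workers 0, 1 and firms 0, 1, and two matchings
-- stable under both whose A₄-join is not stable under B₄.  To reach any size
-- n + m, add m workers and m firms, the k-th new worker matched to the k-th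
-- new firm: old agents rank every new agent last, and new agents rank all
-- agents by index.  Then no new agent is in a blocking pair (an old worker
-- prefers its old partner, an old firm has an old partner by injectivity, and
-- a new firm is wanted only by new workers of larger index, which it ranks
-- below its partner), so padding preserves and reflects stability and
-- commutes with join and meet; hence if the padded instances gave a
-- sublattice, so would A₄ and B₄.
module Submission where

open import Defs
open import Data.Nat using (ℕ; zero; suc; _+_; _≤_; _⊔_; s≤s)
import Data.Nat as ℕ
open import Data.Nat.Properties
  using (n<1+n; m+n≮m; <-trans; ≤-trans; ≮⇒≥; m≤n+m; m≤m⊔n; m≤n⊔m)
open import Data.Empty using (⊥-elim)
open import Data.Fin
  using (Fin; zero; suc; toℕ; _<_; _↑ˡ_; _↑ʳ_; splitAt; join; punchOut; _≟_; _<?_)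
open import Data.Fin.Patterns using (0F; 1F; 2F; 3F)
open import Data.Fin.Properties
  using (any?; all?; pigeonhole; punchOut-injective; <⇒≢; <-asym; ↑ˡ-injective; ↑ʳ-injective;
         splitAt-↑ˡ; splitAt-↑ʳ; splitAt⁻¹-↑ˡ; splitAt⁻¹-↑ʳ; toℕ-↑ˡ; toℕ-↑ʳ; toℕ<n)
open import Data.Fin.Subset using (Subset; _∈_; _∉_; ∣_∣; ⊥; inside)
open import Data.Fin.Subset.Properties using (∣⊥∣≡0)
open import Data.Product using (Σ; _×_; _,_)
open import Data.Sum using (inj₁; inj₂; [_,_]′; map₁)
open import Data.Vec using (Vec; []; _∷_; lookup; here; there)
open import Function using (_∘_)
open import Function.Bundles using (_⇔_; mk⇔; Equivalence)
open import Function.Definitions using (Injective; StrictlySurjective)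
open import Relation.Nullary using (¬_; Dec; yes; no; ¬?)
open import Relation.Nullary.Decidable
  using (True; toWitness; from-yes; from-no; map′; _×-dec_; _→-dec_)
open import Relation.Binary.PropositionalEquality
  using (_≡_; _≢_; _≗_; refl; sym; trans; cong; subst; subst₂; module ≡-Reasoning)

injective⇒strictlySurjective : ∀ {n} {f : Fin n → Fin n} →
  Injective _≡_ _≡_ f → StrictlySurjective _≡_ f
injective⇒strictlySurjective {suc n} {f} f-inj y with any? (λ x → f x ≟ y)
... | yes hit = hit
... | no miss =
  let i , j , i<j , gi≡gj = pigeonhole (n<1+n n) g
  in ⊥-elim (<⇒≢ i<j (f-inj (punchOut-injective (avoids i) (avoids j) gi≡gj)))
  where
    avoids : ∀ x → y ≢ f x
    avoids x y≡fx = miss (x , sym y≡fx)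
    g : Fin (suc n) → Fin n
    g x = punchOut (avoids x)

data SplitView (n m : ℕ) : Fin (n + m) → Set where
  old : ∀ a → SplitView n m (a ↑ˡ m)
  new : ∀ k → SplitView n m (n ↑ʳ k)

splitView : ∀ n {m} (i : Fin (n + m)) → SplitView n m i
splitView n i with splitAt n i in eq
... | inj₁ a = subst (SplitView n _) (splitAt⁻¹-↑ˡ eq) (old a)
... | inj₂ k = subst (SplitView n _) (splitAt⁻¹-↑ʳ eq) (new k)

↑ˡ≢↑ʳ : ∀ {n m} (a : Fin n) (k : Fin m) → a ↑ˡ m ≢ n ↑ʳ k
↑ˡ≢↑ʳ {n} {m} a k e
  with () ← trans (sym (splitAt-↑ˡ n a m)) (trans (cong (splitAt n) e) (splitAt-↑ʳ n m k))

Stable-resp : ∀ {n} (I : Instance n) (M N : Matching n) → mate M ≗ mate N → Stable I M → Stable I N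
Stable-resp I M N M≗N stable w f (unmatched , w≺ , f≺) =
  stable w f
    ( (λ e → unmatched (trans (sym (M≗N w)) e))
    , subst (wpref I w prefers f over_) (sym (M≗N w)) w≺
    , λ w′ e → f≺ w′ (trans (sym (M≗N w′)) e))

joinMate-same : ∀ {n} (I : Instance n) M N w → mate M w ≡ mate N w → joinMate I M N w ≡ mate M w
joinMate-same I M N w e with rank (wpref I w) (mate M w) <? rank (wpref I w) (mate N w)
... | yes _ = sym e
... | no _  = refl

meetMate-same : ∀ {n} (I : Instance n) M N w → mate M w ≡ mate N w → meetMate I M N w ≡ mate M w
meetMate-same I M N w e with rank (wpref I w) (mate M w) <? rank (wpref I w) (mate N w)
... | yes _ = refl
... | no _  = sym e

SameFrom : ∀ {n} → ℕ → (Fin n → Pref n) → (Fin n → Pref n) → Set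
SameFrom k ρ σ = ∀ a → k ≤ toℕ a → SamePref (ρ a) (σ a)

module _ {n : ℕ} (m : ℕ) where

  extend : (Fin n → Fin n) → Fin (n + m) → Fin (n + m)
  extend f = join n m ∘ map₁ f ∘ splitAt n

  extend-↑ˡ : ∀ f a → extend f (a ↑ˡ m) ≡ f a ↑ˡ m
  extend-↑ˡ f a rewrite splitAt-↑ˡ n a m = refl

  extend-↑ʳ : ∀ f k → extend f (n ↑ʳ k) ≡ n ↑ʳ k
  extend-↑ʳ f k rewrite splitAt-↑ʳ n m k = refl

  extend-injective : ∀ {f} → Injective _≡_ _≡_ f → Injective _≡_ _≡_ (extend f)
  extend-injective {f} f-inj {x} {y} e with splitView n x | splitView n y
  ... | old a | old b =
    cong (_↑ˡ m) (f-inj (↑ˡ-injective m _ _ (trans (sym (extend-↑ˡ f a)) (trans e (extend-↑ˡ f b)))))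
  ... | old a | new k = ⊥-elim (↑ˡ≢↑ʳ (f a) k (trans (sym (extend-↑ˡ f a)) (trans e (extend-↑ʳ f k))))
  ... | new k | old b = ⊥-elim (↑ˡ≢↑ʳ (f b) k (trans (sym (extend-↑ˡ f b)) (trans (sym e) (extend-↑ʳ f k))))
  ... | new k | new l =
    cong (n ↑ʳ_) (↑ʳ-injective n _ _ (trans (sym (extend-↑ʳ f k)) (trans e (extend-↑ʳ f l))))

  extend-injective⁻¹ : ∀ {f} → Injective _≡_ _≡_ (extend f) → Injective _≡_ _≡_ f
  extend-injective⁻¹ {f} inj {a} {b} e =
    ↑ˡ-injective m a b (inj (trans (extend-↑ˡ f a) (trans (cong (_↑ˡ m) e) (sym (extend-↑ˡ f b)))))

  extend-cong : ∀ {f g} → f ≗ g → extend f ≗ extend g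
  extend-cong f≗g x with splitAt n x
  ... | inj₁ a = cong (_↑ˡ m) (f≗g a)
  ... | inj₂ k = refl

  padPref : Pref n → Pref (n + m)
  padPref P = record { rank = extend (rank P) ; rank-inj = extend-injective (rank-inj P) }

  idPref : Pref (n + m)
  idPref = record { rank = λ x → x ; rank-inj = λ e → e }

  padPrefs : (Fin n → Pref n) → Fin (n + m) → Pref (n + m)
  padPrefs ρ = [ padPref ∘ ρ , (λ _ → idPref) ]′ ∘ splitAt n

  padInstance : Instance n → Instance (n + m)
  padInstance I = record { wpref = padPrefs (wpref I) ; fpref = padPrefs (fpref I) }

  padMatching : Matching n → Matching (n + m)
  padMatching M = record { mate = extend (mate M) ; mate-inj = extend-injective (mate-inj M) }

  padPrefs-↑ˡ : ∀ ρ a → padPrefs ρ (a ↑ˡ m) ≡ padPref (ρ a)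
  padPrefs-↑ˡ ρ a rewrite splitAt-↑ˡ n a m = refl

  padPrefs-↑ʳ : ∀ ρ k → padPrefs ρ (n ↑ʳ k) ≡ idPref
  padPrefs-↑ʳ ρ k rewrite splitAt-↑ʳ n m k = refl

  padPrefs-prefers-↑ˡ : ∀ ρ a x y →
    padPrefs ρ (a ↑ˡ m) prefers (x ↑ˡ m) over (y ↑ˡ m) ⇔ ρ a prefers x over y
  padPrefs-prefers-↑ˡ ρ a x y rewrite padPrefs-↑ˡ ρ a =
    mk⇔ (subst₂ ℕ._<_ (toℕ-extend-↑ˡ x) (toℕ-extend-↑ˡ y))
        (subst₂ ℕ._<_ (sym (toℕ-extend-↑ˡ x)) (sym (toℕ-extend-↑ˡ y)))
    where
      toℕ-extend-↑ˡ : ∀ b → toℕ (extend (rank (ρ a)) (b ↑ˡ m)) ≡ toℕ (rank (ρ a) b)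
      toℕ-extend-↑ˡ b = trans (cong toℕ (extend-↑ˡ (rank (ρ a)) b)) (toℕ-↑ˡ (rank (ρ a) b) m)

  padPrefs-¬prefers-↑ʳ : ∀ ρ a k y → ¬ (padPrefs ρ (a ↑ˡ m) prefers (n ↑ʳ k) over (y ↑ˡ m))
  padPrefs-¬prefers-↑ʳ ρ a k y k≺y rewrite padPrefs-↑ˡ ρ a =
    m+n≮m n (toℕ k) (<-trans n+k<rank-y (toℕ<n (rank (ρ a) y)))
    where
      n+k<rank-y : n + toℕ k ℕ.< toℕ (rank (ρ a) y)
      n+k<rank-y = subst₂ ℕ._<_
        (trans (cong toℕ (extend-↑ʳ (rank (ρ a)) k)) (toℕ-↑ʳ n k))
        (trans (cong toℕ (extend-↑ˡ (rank (ρ a)) y)) (toℕ-↑ˡ (rank (ρ a) y) m))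
        k≺y

  padPrefs-↑ʳ-prefers : ∀ ρ k {x y} → padPrefs ρ (n ↑ʳ k) prefers x over y → x < y
  padPrefs-↑ʳ-prefers ρ k {x} {y} = subst (λ P → P prefers x over y) (padPrefs-↑ʳ ρ k)

  blocking-pad : ∀ I M a b →
    Blocking (padInstance I) (padMatching M) (a ↑ˡ m) (b ↑ˡ m) ⇔ Blocking I M a b
  blocking-pad I M a b = mk⇔ unpad pad
    where
      mate-↑ˡ : ∀ c → mate (padMatching M) (c ↑ˡ m) ≡ mate M c ↑ˡ m
      mate-↑ˡ = extend-↑ˡ (mate M)

      unpad : Blocking (padInstance I) (padMatching M) (a ↑ˡ m) (b ↑ˡ m) → Blocking I M a b
      unpad (unmatched , a≺ , b≺) =
        (λ e → unmatched (trans (mate-↑ˡ a) (cong (_↑ˡ m) e))) ,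
        Equivalence.to (padPrefs-prefers-↑ˡ (wpref I) a b (mate M a))
          (subst (padPrefs (wpref I) (a ↑ˡ m) prefers b ↑ˡ m over_) (mate-↑ˡ a) a≺) ,
        λ c e → Equivalence.to (padPrefs-prefers-↑ˡ (fpref I) b a c)
          (b≺ (c ↑ˡ m) (trans (mate-↑ˡ c) (cong (_↑ˡ m) e)))

      pad : Blocking I M a b → Blocking (padInstance I) (padMatching M) (a ↑ˡ m) (b ↑ˡ m)
      pad (unmatched , a≺ , b≺) =
        (λ e → unmatched (↑ˡ-injective m _ _ (trans (sym (mate-↑ˡ a)) e))) ,
        subst (padPrefs (wpref I) (a ↑ˡ m) prefers b ↑ˡ m over_) (sym (mate-↑ˡ a))
          (Equivalence.from (padPrefs-prefers-↑ˡ (wpref I) a b (mate M a)) a≺) ,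
        b≺′
        where
          b≺′ : ∀ w → mate (padMatching M) w ≡ b ↑ˡ m →
                padPrefs (fpref I) (b ↑ˡ m) prefers (a ↑ˡ m) over w
          b≺′ w e with splitView n w
          ... | old c = Equivalence.from (padPrefs-prefers-↑ˡ (fpref I) b a c)
                          (b≺ c (↑ˡ-injective m _ _ (trans (sym (mate-↑ˡ c)) e)))
          ... | new k = ⊥-elim (↑ˡ≢↑ʳ b k (trans (sym e) (extend-↑ʳ (mate M) k)))

  stable-pad : ∀ {I M} → Stable I M → Stable (padInstance I) (padMatching M)
  stable-pad {I} {M} stable w f blocking@(_ , w≺ , f≺) with splitView n w | splitView n f
  ... | old a | old b = stable a b (Equivalence.to (blocking-pad I M a b) blocking)
  ... | old a | new k =
    padPrefs-¬prefers-↑ʳ (wpref I) a k (mate M a)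
      (subst (padPrefs (wpref I) (a ↑ˡ m) prefers n ↑ʳ k over_) (extend-↑ˡ (mate M) a) w≺)
  ... | new k | old b =
    let c , c↦b = injective⇒strictlySurjective (mate-inj M) b in
    padPrefs-¬prefers-↑ʳ (fpref I) b k c
      (f≺ (c ↑ˡ m) (trans (extend-↑ˡ (mate M) c) (cong (_↑ˡ m) c↦b)))
  ... | new k | new l =
    <-asym (padPrefs-↑ʳ-prefers (wpref I) k
             (subst (padPrefs (wpref I) (n ↑ʳ k) prefers n ↑ʳ l over_) (extend-↑ʳ (mate M) k) w≺))
           (padPrefs-↑ʳ-prefers (fpref I) l (f≺ (n ↑ʳ l) (extend-↑ʳ (mate M) l)))

  stable-unpad : ∀ {I M} → Stable (padInstance I) (padMatching M) → Stable I M
  stable-unpad {I} {M} stable a b blocking =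
    stable (a ↑ˡ m) (b ↑ˡ m) (Equivalence.from (blocking-pad I M a b) blocking)

  padInstance-prefers-mates : ∀ I M N a →
    wpref (padInstance I) (a ↑ˡ m)
      prefers mate (padMatching M) (a ↑ˡ m) over mate (padMatching N) (a ↑ˡ m)
    ⇔ wpref I a prefers mate M a over mate N a
  padInstance-prefers-mates I M N a rewrite extend-↑ˡ (mate M) a | extend-↑ˡ (mate N) a =
    padPrefs-prefers-↑ˡ (wpref I) a (mate M a) (mate N a)

  joinMate-pad-↑ˡ : ∀ I M N a →
    joinMate (padInstance I) (padMatching M) (padMatching N) (a ↑ˡ m) ≡ joinMate I M N a ↑ˡ m
  joinMate-pad-↑ˡ I M N a
    with rank (wpref I a) (mate M a) <? rank (wpref I a) (mate N a)
       | rank (wpref (padInstance I) (a ↑ˡ m)) (mate (padMatching M) (a ↑ˡ m))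
           <? rank (wpref (padInstance I) (a ↑ˡ m)) (mate (padMatching N) (a ↑ˡ m))
  ... | yes _ | yes _ = extend-↑ˡ (mate N) a
  ... | no _  | no _  = extend-↑ˡ (mate M) a
  ... | yes M≺N | no M⊀N = ⊥-elim (M⊀N (Equivalence.from (padInstance-prefers-mates I M N a) M≺N))
  ... | no M⊀N | yes M≺N = ⊥-elim (M⊀N (Equivalence.to (padInstance-prefers-mates I M N a) M≺N))

  meetMate-pad-↑ˡ : ∀ I M N a →
    meetMate (padInstance I) (padMatching M) (padMatching N) (a ↑ˡ m) ≡ meetMate I M N a ↑ˡ m
  meetMate-pad-↑ˡ I M N a
    with rank (wpref I a) (mate M a) <? rank (wpref I a) (mate N a)
       | rank (wpref (padInstance I) (a ↑ˡ m)) (mate (padMatching M) (a ↑ˡ m))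
           <? rank (wpref (padInstance I) (a ↑ˡ m)) (mate (padMatching N) (a ↑ˡ m))
  ... | yes _ | yes _ = extend-↑ˡ (mate M) a
  ... | no _  | no _  = extend-↑ˡ (mate N) a
  ... | yes M≺N | no M⊀N = ⊥-elim (M⊀N (Equivalence.from (padInstance-prefers-mates I M N a) M≺N))
  ... | no M⊀N | yes M≺N = ⊥-elim (M⊀N (Equivalence.to (padInstance-prefers-mates I M N a) M≺N))

  joinMate-pad : ∀ I M N →
    joinMate (padInstance I) (padMatching M) (padMatching N) ≗ extend (joinMate I M N)
  joinMate-pad I M N w with splitView n w
  ... | old a = trans (joinMate-pad-↑ˡ I M N a) (sym (extend-↑ˡ (joinMate I M N) a))
  ... | new k = begin
    joinMate (padInstance I) (padMatching M) (padMatching N) (n ↑ʳ k)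
      ≡⟨ joinMate-same (padInstance I) (padMatching M) (padMatching N) (n ↑ʳ k)
           (trans (extend-↑ʳ (mate M) k) (sym (extend-↑ʳ (mate N) k))) ⟩
    extend (mate M) (n ↑ʳ k)  ≡⟨ extend-↑ʳ (mate M) k ⟩
    n ↑ʳ k                    ≡⟨ extend-↑ʳ (joinMate I M N) k ⟨
    extend (joinMate I M N) (n ↑ʳ k) ∎
    where open ≡-Reasoning

  meetMate-pad : ∀ I M N →
    meetMate (padInstance I) (padMatching M) (padMatching N) ≗ extend (meetMate I M N)
  meetMate-pad I M N w with splitView n w
  ... | old a = trans (meetMate-pad-↑ˡ I M N a) (sym (extend-↑ˡ (meetMate I M N) a))
  ... | new k = begin
    meetMate (padInstance I) (padMatching M) (padMatching N) (n ↑ʳ k)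
      ≡⟨ meetMate-same (padInstance I) (padMatching M) (padMatching N) (n ↑ʳ k)
           (trans (extend-↑ʳ (mate M) k) (sym (extend-↑ʳ (mate N) k))) ⟩
    extend (mate M) (n ↑ʳ k)  ≡⟨ extend-↑ʳ (mate M) k ⟩
    n ↑ʳ k                    ≡⟨ extend-↑ʳ (meetMate I M N) k ⟨
    extend (meetMate I M N) (n ↑ʳ k) ∎
    where open ≡-Reasoning

  commonStable-unpad : ∀ {I J g} (N : Matching (n + m)) → mate N ≗ extend g →
    CommonStable (padInstance I) (padInstance J) N →
    Σ (Injective _≡_ _≡_ g) λ g-inj → CommonStable I J record { mate = g ; mate-inj = g-inj }
  commonStable-unpad {I} {J} {g} N N≗g (NI , NJ) =
    g-inj , stable-unpad {I} {G} (Stable-resp (padInstance I) N (padMatching G) N≗g NI) ,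
            stable-unpad {J} {G} (Stable-resp (padInstance J) N (padMatching G) N≗g NJ)
    where
      g-inj : Injective _≡_ _≡_ g
      g-inj = extend-injective⁻¹ λ {x} {y} e → mate-inj N (trans (N≗g x) (trans e (sym (N≗g y))))
      G : Matching n
      G = record { mate = g ; mate-inj = g-inj }

  isSublattice-unpad : ∀ {I J} →
    IsSublattice (padInstance I) (CommonStable (padInstance I) (padInstance J)) →
    IsSublattice I (CommonStable I J)
  isSublattice-unpad {I} {J} closed M N (MI , MJ) (NI , NJ)
    with closed (padMatching M) (padMatching N)
                (stable-pad {I} {M} MI , stable-pad {J} {M} MJ)
                (stable-pad {I} {N} NI , stable-pad {J} {N} NJ)
  ... | (join-inj , join-stable) , (meet-inj , meet-stable) =
    commonStable-unpad (record { mate-inj = join-inj }) (joinMate-pad I M N) join-stable ,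
    commonStable-unpad (record { mate-inj = meet-inj }) (meetMate-pad I M N) meet-stable

  padPrefs-sameFrom : ∀ {k ρ σ} → SameFrom k ρ σ → SameFrom k (padPrefs ρ) (padPrefs σ)
  padPrefs-sameFrom {k} {ρ} {σ} same w k≤w with splitView n w
  ... | old a rewrite padPrefs-↑ˡ ρ a | padPrefs-↑ˡ σ a =
    extend-cong (same a (subst (k ≤_) (toℕ-↑ˡ a m) k≤w))
  ... | new l rewrite padPrefs-↑ʳ ρ l | padPrefs-↑ʳ σ l = λ _ → refl

initial : ℕ → (n : ℕ) → Subset n
initial zero    n       = ⊥
initial (suc k) zero    = []
initial (suc k) (suc n) = inside ∷ initial k n

∣initial∣ : ∀ {k n} → k ≤ n → ∣ initial k n ∣ ≡ k
∣initial∣ {zero}  {n} _       = ∣⊥∣≡0 n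
∣initial∣ {suc k} (s≤s k≤n) = cong suc (∣initial∣ k≤n)

<⇒∈-initial : ∀ {k n} {i : Fin n} → toℕ i ℕ.< k → i ∈ initial k n
<⇒∈-initial {suc k} {suc n} {zero}  _         = here
<⇒∈-initial {suc k} {suc n} {suc i} (s≤s i<k) = there (<⇒∈-initial i<k)

sameFrom-outside : ∀ {n k p} {ρ σ : Fin n → Pref n} → SameFrom k ρ σ → k ≤ p →
  ∀ a → a ∉ initial p n → SamePref (ρ a) (σ a)
sameFrom-outside same k≤p a a∉ = same a (≤-trans k≤p (≮⇒≥ (a∉ ∘ <⇒∈-initial)))

sameFrom⇒IsPQ : ∀ {n k p q} {A B : Instance n} →
  SameFrom k (wpref A) (wpref B) → SameFrom k (fpref A) (fpref B) →
  k ≤ p → k ≤ q → p ≤ n → q ≤ n → IsPQ p q A B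
sameFrom⇒IsPQ {n} {p = p} {q} {A} {B} sameW sameF k≤p k≤q p≤n q≤n =
  initial p n , initial q n , ∣initial∣ p≤n , ∣initial∣ q≤n ,
  sameFrom-outside {ρ = wpref A} {wpref B} sameW k≤p ,
  sameFrom-outside {ρ = fpref A} {fpref B} sameF k≤q

injective? : ∀ {m n} (f : Fin m → Fin n) → Dec (Injective _≡_ _≡_ f)
injective? f = map′ (λ inj {x} {y} → inj x y) (λ inj x y → inj)
  (all? λ x → all? λ y → (f x ≟ f y) →-dec (x ≟ y))

stable? : ∀ {n} (I : Instance n) (M : Matching n) → Dec (Stable I M)
stable? I M = all? λ w → all? λ f → ¬? (blocking? w f)
  where
    blocking? : ∀ w f → Dec (Blocking I M w f)
    blocking? w f =
      ¬? (mate M w ≟ f) ×-dec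
      rank (wpref I w) f <? rank (wpref I w) (mate M w) ×-dec
      all? λ w′ → (mate M w′ ≟ f) →-dec (rank (fpref I f) w <? rank (fpref I f) w′)

-- Entry x of a table is the rank of agent x (0 = most preferred).
preference : ∀ {n} (ranks : Vec (Fin n) n) → {True (injective? (lookup ranks))} → Pref n
preference ranks {inj} = record { rank = lookup ranks ; rank-inj = toWitness inj }

matching : ∀ {n} (mates : Vec (Fin n) n) → {True (injective? (lookup mates))} → Matching n
matching mates {inj} = record { mate = lookup mates ; mate-inj = toWitness inj }

A₄ B₄ : Instance 4
A₄ = record
  { wpref = lookup ( preference (1F ∷ 0F ∷ 2F ∷ 3F ∷ [])
                   ∷ preference (0F ∷ 3F ∷ 1F ∷ 2F ∷ [])
                   ∷ preference (1F ∷ 2F ∷ 3F ∷ 0F ∷ [])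
                   ∷ preference (3F ∷ 2F ∷ 0F ∷ 1F ∷ []) ∷ [])
  ; fpref = lookup ( preference (0F ∷ 1F ∷ 2F ∷ 3F ∷ [])
                   ∷ preference (2F ∷ 0F ∷ 3F ∷ 1F ∷ [])
                   ∷ preference (2F ∷ 3F ∷ 0F ∷ 1F ∷ [])
                   ∷ preference (0F ∷ 3F ∷ 2F ∷ 1F ∷ []) ∷ [])
  }
B₄ = record
  { wpref = lookup ( preference (0F ∷ 2F ∷ 1F ∷ 3F ∷ [])
                   ∷ preference (3F ∷ 2F ∷ 1F ∷ 0F ∷ [])
                   ∷ preference (1F ∷ 2F ∷ 3F ∷ 0F ∷ [])
                   ∷ preference (3F ∷ 2F ∷ 0F ∷ 1F ∷ []) ∷ [])
  ; fpref = lookup ( preference (2F ∷ 0F ∷ 1F ∷ 3F ∷ [])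
                   ∷ preference (0F ∷ 1F ∷ 2F ∷ 3F ∷ [])
                   ∷ preference (2F ∷ 3F ∷ 0F ∷ 1F ∷ [])
                   ∷ preference (0F ∷ 3F ∷ 2F ∷ 1F ∷ []) ∷ [])
  }

M₁ M₂ : Matching 4
M₁ = matching (0F ∷ 1F ∷ 3F ∷ 2F ∷ [])
M₂ = matching (1F ∷ 0F ∷ 2F ∷ 3F ∷ [])

A₄-B₄-workers : SameFrom 2 (wpref A₄) (wpref B₄)
A₄-B₄-workers 1F (s≤s ())
A₄-B₄-workers 2F _ _ = refl
A₄-B₄-workers 3F _ _ = refl

A₄-B₄-firms : SameFrom 2 (fpref A₄) (fpref B₄)
A₄-B₄-firms 1F (s≤s ())
A₄-B₄-firms 2F _ _ = refl
A₄-B₄-firms 3F _ _ = refl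

-- The A₄-join of M₁ and M₂ matches worker 2 to firm 2 and worker 0 to firm 0,
-- and under B₄ worker 2 and firm 0 prefer each other to these partners.
¬isSublattice₄ : ¬ IsSublattice A₄ (CommonStable A₄ B₄)
¬isSublattice₄ closed =
  let (join-inj , _ , join-B₄-stable) , _ =
        closed M₁ M₂ (from-yes (stable? A₄ M₁) , from-yes (stable? B₄ M₁))
                     (from-yes (stable? A₄ M₂) , from-yes (stable? B₄ M₂))
  in from-no (stable? B₄ record { mate = joinMate A₄ M₁ M₂ ; mate-inj = join-inj }) join-B₄-stable

theorem10 : (p q : ℕ) → 2 ≤ p → 2 ≤ q →
    Σ ℕ λ n → (p ⊔ q) ≤ n ×
    Σ (Instance n) λ A → Σ (Instance n) λ B →
    IsPQ p q A B × ¬ IsSublattice A (CommonStable A B)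
theorem10 p q 2≤p 2≤q =
  4 + m , m≤n+m m 4 , A , B ,
  sameFrom⇒IsPQ {A = A} {B} (padPrefs-sameFrom m A₄-B₄-workers) (padPrefs-sameFrom m A₄-B₄-firms)
    2≤p 2≤q (≤-trans (m≤m⊔n p q) (m≤n+m m 4)) (≤-trans (m≤n⊔m p q) (m≤n+m m 4)) ,
  ¬isSublattice₄ ∘ isSublattice-unpad m
  where
    m : ℕ
    m = p ⊔ q
    A B : Instance (4 + m)
    A = padInstance m A₄
    B = padInstance m B₄
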